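{- Let $(A,\leq,0,1)$ be a finite bounded poset, $(T,R)$ a time frame with reflexive $R$ and $X\in\{P,F,H,G\}$. Then $H*X\leq X$, $G*X\leq X$, $X\leq P*X$ and $X\leq F*X$; in particular $P\leq P*P$, $F\leq F*F$, $H*H\leq H$ and $G*G\leq G$.
   Context: For $D\subseteq A$: $L(D)$, $U(D)$ are the sets of lower and upper bounds; $\operatorname{Max}D$, $\operatorname{Min}D$ the sets of maximal and minimal elements. A time frame is $(T,R)$ with $T\neq\emptyset$, $R\subseteq T^2$. Tense operators on nonempty $B\subseteq A^T$ (with $q\in A^T$ identified with $\{q\}$) and $s\in T$: $P(B)(s)=\operatorname{Min}U(\{q(t)\mid q\in B,t\mathrel Rs\})$, $F(B)(s)=\operatorname{Min}U(\{q(t)\mid q\in B,s\mathrel Rt\})$, $H(B)(s)=\operatorname{Max}L(\{q(t)\mid q\in B,t\mathrel Rs\})$, $G(B)(s)=\operatorname{Max}L(\{q(t)\mid q\in B,s\mathrel Rt\})$, with values in $(2^A\setminus\{\emptyset\})^T$. The transformation function is $\varphi(x)=\{q\in A^T\mid q(t)\in x(t)\ \forall t\in T\}$, and $Y*X:=Y\circ\varphi\circ X$. For nonempty $D,E\subseteq A$, $D\leq E$ iff $d\leq e$ for all $d\in D,e\in E$; for maps $X,Y\colon A^T\to(2^A\setminus\{\emptyset\})^T$, $X\leq Y$ means $X(q)(s)\leq Y(q)(s)$ for all $q\in A^T$, $s\in T$. -}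

module Defs where

open import Level using (0ℓ)
open import Data.Nat using (ℕ)
open import Data.Fin using (Fin)
open import Data.Product using (Σ; ∃; ∃-syntax; _×_; _,_)
open import Relation.Binary.PropositionalEquality using (_≡_)
open import Relation.Binary.Structures using (IsPartialOrder)
open import Relation.Binary.Definitions using (Reflexive)

record FiniteBoundedPoset : Set₁ where
  field
    Carrier        : Set
    _≤_            : Carrier → Carrier → Set
    isPartialOrder : IsPartialOrder _≡_ _≤_
    𝟘 𝟙            : Carrier
    𝟘-min          : ∀ a → 𝟘 ≤ a
    𝟙-max          : ∀ a → a ≤ 𝟙
    size           : ℕ
    enum           : Fin size → Carrier
    enum-surj      : ∀ a → ∃[ i ] enum i ≡ a

record TimeFrame : Set₁ where
  field
    T        : Set
    R        : T → T → Set
    inhabited : T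

data TenseOp : Set where
  𝐏 𝐅 𝐇 𝐆 : TenseOp

module Tense (𝔸 : FiniteBoundedPoset) (𝕋 : TimeFrame) where
  open FiniteBoundedPoset 𝔸
  open TimeFrame 𝕋

  A : Set
  A = Carrier

  Sub : Set₁
  Sub = A → Set

  LB UB : Sub → Sub
  LB D a = ∀ d → D d → a ≤ d
  UB D a = ∀ d → D d → d ≤ a

  Min Max : Sub → Sub
  Min D a = D a × (∀ b → D b → b ≤ a → b ≡ a)
  Max D a = D a × (∀ b → D b → a ≤ b → b ≡ a)

  SubF : Set₁
  SubF = (T → A) → Set

  pastVals futVals : SubF → T → Sub
  pastVals B s a = ∃[ q ] ∃[ t ] (B q × R t s × a ≡ q t)
  futVals  B s a = ∃[ q ] ∃[ t ] (B q × R s t × a ≡ q t)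

  Op : Set₁
  Op = SubF → T → Sub

  P F H G : Op
  P B s = Min (UB (pastVals B s))
  F B s = Min (UB (futVals B s))
  H B s = Max (LB (pastVals B s))
  G B s = Max (LB (futVals B s))

  op : TenseOp → Op
  op 𝐏 = P
  op 𝐅 = F
  op 𝐇 = H
  op 𝐆 = G

  single : (T → A) → SubF
  single q r = r ≡ q

  Map : Set₁
  Map = (T → A) → T → Sub

  ⟦_⟧ : Op → Map
  ⟦ X ⟧ q = X (single q)

  φ : (T → Sub) → SubF
  φ x q = ∀ t → x t (q t)

  _*_ : Op → Map → Map
  (Y * X) q = Y (φ (X q))

  _⊑_ : Sub → Sub → Set
  D ⊑ E = ∀ d e → D d → E e → d ≤ e

  _≤ᴹ_ : Map → Map → Set
  X ≤ᴹ Y = ∀ q s → X q s ⊑ Y q s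

-- Since R is reflexive, every value d ∈ X(q)(s) is attained at time s by some
-- q' ∈ φ(X(q)), namely any selector of X(q) passing through d at s; such a
-- selector exists because, A being finite and bounded, each Min U(D) and
-- Max L(D) is nonempty (1 ∈ U(D), 0 ∈ L(D)). Hence d lies in the set whose
-- lower bounds H and G take and whose upper bounds P and F take.
module Submission where

open import Defs
open import Level using (0ℓ)
open import Data.Nat using (zero; suc)
open import Data.Fin using (Fin; zero; suc)
open import Data.Product using (∃; ∃-syntax; _×_; _,_; proj₁; proj₂)
open import Relation.Nullary using (yes; no; contradiction)
open import Relation.Binary.PropositionalEquality using (_≡_; refl; sym)
open import Relation.Binary.Structures using (IsPartialOrder)
open import Relation.Binary.Definitions using (Reflexive)
import Relation.Binary.Construct.Flip.EqAndOrd as Flip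
open import Axiom.ExcludedMiddle using (ExcludedMiddle)

Minimal : {A : Set} → (A → A → Set) → (A → Set) → A → Set
Minimal _≤_ S a = S a × (∀ b → S b → b ≤ a → b ≡ a)

module FiniteMinimal (em : ExcludedMiddle 0ℓ) {A : Set} {_≤_ : A → A → Set}
  (isPartialOrder : IsPartialOrder _≡_ _≤_) where
  open IsPartialOrder isPartialOrder using (trans; antisym)

  minimal-among : ∀ n (f : Fin n → A) (S : A → Set) → ∃ S →
                  ∃[ m ] S m × (∀ i → S (f i) → f i ≤ m → f i ≡ m)
  minimal-among zero f S (a , a∈S) = a , a∈S , λ ()
  minimal-among (suc n) f S inhabited
    with minimal-among n (λ i → f (suc i)) S inhabited
  ... | m , m∈S , m-min with em {S (f zero) × f zero ≤ m}
  ... | no ¬below = m , m∈S , keep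
    where
    keep : ∀ i → S (f i) → f i ≤ m → f i ≡ m
    keep zero    f₀∈S f₀≤m = contradiction (f₀∈S , f₀≤m) ¬below
    keep (suc i) = m-min i
  ... | yes (f₀∈S , f₀≤m) = f zero , f₀∈S , replace
    where
    replace : ∀ i → S (f i) → f i ≤ f zero → f i ≡ f zero
    replace zero    _   _    = refl
    replace (suc i) fi∈S fi≤f₀ = squeeze (m-min i fi∈S (trans fi≤f₀ f₀≤m))
      where
      -- f i ≡ m forces m ≤ f zero, so f zero ≡ m as well.
      squeeze : f (suc i) ≡ m → f (suc i) ≡ f zero
      squeeze refl = antisym fi≤f₀ f₀≤m

  minimal-exists : ∀ n (enum : Fin n → A) → (∀ a → ∃[ i ] enum i ≡ a) →
                   (S : A → Set) → ∃ S → ∃ (Minimal _≤_ S)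
  minimal-exists n enum surj S inhabited
    with minimal-among n enum S inhabited
  ... | m , m∈S , m-min = m , m∈S , λ b b∈S b≤m → via (surj b) b∈S b≤m
    where
    via : ∀ {b} → ∃[ i ] enum i ≡ b → S b → b ≤ m → b ≡ m
    via (i , refl) = m-min i

module TenseProperties (em : ExcludedMiddle 0ℓ) (𝔸 : FiniteBoundedPoset)
  (𝕋 : TimeFrame) where
  open FiniteBoundedPoset 𝔸
  open TimeFrame 𝕋
  open Tense 𝔸 𝕋
  module Up   = FiniteMinimal em isPartialOrder
  module Down = FiniteMinimal em (Flip.isPartialOrder isPartialOrder)

  op-nonempty : ∀ X (B : SubF) s → ∃ (op X B s)
  op-nonempty 𝐏 B s = Up.minimal-exists size enum enum-surj _ (𝟙 , λ d _ → 𝟙-max d)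
  op-nonempty 𝐅 B s = Up.minimal-exists size enum enum-surj _ (𝟙 , λ d _ → 𝟙-max d)
  op-nonempty 𝐇 B s = Down.minimal-exists size enum enum-surj _ (𝟘 , λ d _ → 𝟘-min d)
  op-nonempty 𝐆 B s = Down.minimal-exists size enum enum-surj _ (𝟘 , λ d _ → 𝟘-min d)

  φ-selector-through : (x : T → Sub) → (∀ t → ∃ (x t)) → ∀ {s d} → x s d →
                       ∃[ r ] φ x r × r s ≡ d
  φ-selector-through x choice {s} {d} d∈xs = r , r∈φx , r-at-s
    where
    r : T → A
    r t with em {t ≡ s}
    ... | yes _ = d
    ... | no  _ = proj₁ (choice t)
    r∈φx : φ x r
    r∈φx t with em {t ≡ s}
    ... | yes refl = d∈xs
    ... | no  _    = proj₂ (choice t)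
    r-at-s : r s ≡ d
    r-at-s with em {s ≡ s}
    ... | yes _  = refl
    ... | no s≢s = contradiction refl s≢s

  module _ (R-refl : Reflexive R) (x : T → Sub) (choice : ∀ t → ∃ (x t))
    {s : T} where

    ∈pastVals-φ : ∀ {d} → x s d → pastVals (φ x) s d
    ∈pastVals-φ d∈xs with φ-selector-through x choice d∈xs
    ... | r , r∈φx , r-at-s = r , s , r∈φx , R-refl , sym r-at-s

    ∈futVals-φ : ∀ {d} → x s d → futVals (φ x) s d
    ∈futVals-φ d∈xs with φ-selector-through x choice d∈xs
    ... | r , r∈φx , r-at-s = r , s , r∈φx , R-refl , sym r-at-s

    H-φ-⊑ : H (φ x) s ⊑ x s
    H-φ-⊑ _ e (lower , _) e∈xs = lower e (∈pastVals-φ e∈xs)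

    G-φ-⊑ : G (φ x) s ⊑ x s
    G-φ-⊑ _ e (lower , _) e∈xs = lower e (∈futVals-φ e∈xs)

    ⊑-P-φ : x s ⊑ P (φ x) s
    ⊑-P-φ d _ d∈xs (upper , _) = upper d (∈pastVals-φ d∈xs)

    ⊑-F-φ : x s ⊑ F (φ x) s
    ⊑-F-φ d _ d∈xs (upper , _) = upper d (∈futVals-φ d∈xs)

theorem12 : ExcludedMiddle 0ℓ → (𝔸 : FiniteBoundedPoset) (𝕋 : TimeFrame) →
    Reflexive (TimeFrame.R 𝕋) →
    let open Tense 𝔸 𝕋 in
    (∀ (X : TenseOp) →
        ((H * ⟦ op X ⟧) ≤ᴹ ⟦ op X ⟧) × ((G * ⟦ op X ⟧) ≤ᴹ ⟦ op X ⟧)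
      × (⟦ op X ⟧ ≤ᴹ (P * ⟦ op X ⟧)) × (⟦ op X ⟧ ≤ᴹ (F * ⟦ op X ⟧)))
    × (⟦ P ⟧ ≤ᴹ (P * ⟦ P ⟧)) × (⟦ F ⟧ ≤ᴹ (F * ⟦ F ⟧))
    × ((H * ⟦ H ⟧) ≤ᴹ ⟦ H ⟧) × ((G * ⟦ G ⟧) ≤ᴹ ⟦ G ⟧)
theorem12 em 𝔸 𝕋 R-refl = general , ⊑P 𝐏 , ⊑F 𝐅 , H⊑ 𝐇 , G⊑ 𝐆
  where
  open TenseProperties em 𝔸 𝕋
  open Tense 𝔸 𝕋

  nonempty : ∀ X q t → ∃ (⟦ op X ⟧ q t)
  nonempty X q = op-nonempty X (single q)

  H⊑ : ∀ X → (H * ⟦ op X ⟧) ≤ᴹ ⟦ op X ⟧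
  H⊑ X q s = H-φ-⊑ R-refl (⟦ op X ⟧ q) (nonempty X q)
  G⊑ : ∀ X → (G * ⟦ op X ⟧) ≤ᴹ ⟦ op X ⟧
  G⊑ X q s = G-φ-⊑ R-refl (⟦ op X ⟧ q) (nonempty X q)
  ⊑P : ∀ X → ⟦ op X ⟧ ≤ᴹ (P * ⟦ op X ⟧)
  ⊑P X q s = ⊑-P-φ R-refl (⟦ op X ⟧ q) (nonempty X q)
  ⊑F : ∀ X → ⟦ op X ⟧ ≤ᴹ (F * ⟦ op X ⟧)
  ⊑F X q s = ⊑-F-φ R-refl (⟦ op X ⟧ q) (nonempty X q)

  general : ∀ X → ((H * ⟦ op X ⟧) ≤ᴹ ⟦ op X ⟧) × ((G * ⟦ op X ⟧) ≤ᴹ ⟦ op X ⟧)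
                × (⟦ op X ⟧ ≤ᴹ (P * ⟦ op X ⟧)) × (⟦ op X ⟧ ≤ᴹ (F * ⟦ op X ⟧))
  general X = H⊑ X , G⊑ X , ⊑P X , ⊑F X
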